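{- For all positive integers $k$ and $i$ with $1\le i\le k$, the sets $\Pi_{i,k}$ and $\Pi_{i,k}^c$ are minimal unavoidable sets.
   Context: A totally vincular pattern of length $k$, written $\overline{\pi}$ for $\pi\in S_k$, is the pattern $\pi$ with all $k$ entries required to be consecutive; $\overline{S_k}$ is the set of all of them. A cyclic permutation $[\sigma]$ of length $n$ (the set of all rotations of $\sigma\in S_n$) contains $\overline{\pi}$ if some $k$ cyclically consecutive entries $\sigma_j\sigma_{j+1}\cdots\sigma_{j+k-1}$ (indices mod $n$, $n\ge k$) are order-isomorphic to $\pi$; otherwise it avoids it. $\mathrm{Av}_n[\Pi]$ is the set of cyclic permutations of length $n$ avoiding every pattern in $\Pi$. A set $\Pi\subseteq\overline{S_k}$ is unavoidable if $|\mathrm{Av}_n[\Pi]|=0$ for all sufficiently large $n$, and avoidable otherwise; it is a minimal unavoidable set if it is unavoidable but every proper subset is avoidable. $\Pi_{i,k}$ is the set of all $\overline{\pi}\in\overline{S_k}$ with $\pi_i=1$, and $\Pi_{i,k}^c$ is the set of all $\overline{\pi}\in\overline{S_k}$ with $\pi_i=k$. -}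

module Defs where

open import Data.Nat using (ℕ; zero; suc; _+_; _<_; _≤_)
open import Data.Nat.DivMod using (_%_; m%n<n)
open import Data.Fin using (Fin; toℕ; fromℕ<)
open import Data.Vec using (Vec; lookup)
open import Data.Product using (Σ; ∃; ∃-syntax; _×_; _,_)
open import Data.Empty using (⊥)
open import Relation.Nullary using (¬_)
open import Relation.Binary.PropositionalEquality using (_≡_)
open import Function.Bundles using (_⇔_)

-- A permutation of length n in one-line notation, with values 0,…,n-1
-- (i.e. the paper's value v is represented by v-1): a vector of
-- length n over Fin n whose entries are pairwise distinct.
IsPerm : ∀ {n} → Vec (Fin n) n → Set
IsPerm {n} v = ∀ (a b : Fin n) → lookup v a ≡ lookup v b → a ≡ b

-- A (totally vincular) pattern of length k is a permutation in S_k;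
-- a set of patterns is a predicate on one-line words (intended to hold
-- only of permutations).
Word : ℕ → Set
Word k = Vec (Fin k) k

PatternSet : ℕ → Set₁
PatternSet k = Word k → Set

cyc : ∀ {n} → Vec (Fin n) n → ℕ → ℕ
cyc {zero} _ _ = 0
cyc {suc n} σ m = toℕ (lookup σ (fromℕ< (m%n<n m (suc n))))

OccursAt : ∀ {n k} → Vec (Fin n) n → Word k → Fin n → Set
OccursAt {n} {k} σ π j =
  ∀ (a b : Fin k) →
    (cyc σ (toℕ j + toℕ a) < cyc σ (toℕ j + toℕ b)) ⇔ (toℕ (lookup π a) < toℕ (lookup π b))

Contains : ∀ {n k} → Vec (Fin n) n → Word k → Set
Contains {n} {k} σ π = k ≤ n × ∃[ j ] OccursAt σ π j

AvoidsAll : ∀ {n k} → Vec (Fin n) n → PatternSet k → Set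
AvoidsAll σ Π = ∀ π → Π π → ¬ Contains σ π

Unavoidable : ∀ {k} → PatternSet k → Set
Unavoidable {k} Π =
  ∃[ N ] ∀ n → N ≤ n → ∀ (σ : Vec (Fin n) n) → IsPerm σ → ¬ AvoidsAll σ Π

Avoidable : ∀ {k} → PatternSet k → Set
Avoidable Π = ¬ Unavoidable Π

_⊆_ : ∀ {k} → PatternSet k → PatternSet k → Set
Π' ⊆ Π = ∀ π → Π' π → Π π

_⊂_ : ∀ {k} → PatternSet k → PatternSet k → Set
Π' ⊂ Π = (Π' ⊆ Π) × ∃[ π ] (Π π × ¬ Π' π)

MinimalUnavoidable : ∀ {k} → PatternSet k → Set₁
MinimalUnavoidable {k} Π =
  Unavoidable Π × (∀ (Π' : PatternSet k) → Π' ⊂ Π → Avoidable Π')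

-- Π_{i,k}: patterns π ∈ S_k with π_i = 1 (value 0 here; i is 0-based)
Πlow : (k : ℕ) → Fin k → PatternSet k
Πlow k i π = IsPerm π × toℕ (lookup π i) ≡ 0

-- Π^c_{i,k}: patterns π ∈ S_k with π_i = k (value k-1 here)
Πhigh : (k : ℕ) → Fin k → PatternSet k
Πhigh k i π = IsPerm π × suc (toℕ (lookup π i)) ≡ k

-- Unavoidability: in any cyclic permutation of length n ≥ k, the window of
-- length k that puts the global minimum (maximum) at its i-th place is an
-- occurrence of a pattern of Π_{i,k} (Π^c_{i,k}).
--
-- Minimality: for π ∈ Π_{i,k} (or Π^c_{i,k}) and m ≥ 1, the permutation of
-- length mk with entries σ_t = m·π(t mod k) + ⌊t/k⌋ has, in every window of
-- length k, the relative order of a cyclic rotation of π.  The only rotation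
-- taking the same value as π at position i is π itself, so this cyclic
-- permutation avoids every pattern of the family except π; hence removing π
-- from the family makes it avoidable.
{-# OPTIONS --safe #-}
module Submission where

open import Defs
open import Data.Nat using (ℕ; zero; suc; _+_; _*_; _∸_; _<_; _≤_; z≤n; s≤s; s≤s⁻¹; _<?_; NonZero)
open import Data.Nat.Properties
open import Data.Nat.DivMod
open import Data.Nat.Divisibility using (n∣m*n)
open import Data.Nat.Induction using (<-rec)
open import Data.Fin using (Fin; toℕ; fromℕ<; fromℕ; punchOut) renaming (zero to fzero; suc to fsuc)
open import Data.Fin.Properties
  using (toℕ-injective; toℕ<n; toℕ-fromℕ<; toℕ-fromℕ; punchOut-injective; any?; injective⇒≤)
  renaming (suc-injective to fsuc-injective; _≟_ to _≟ᶠ_)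
open import Data.Vec using (Vec; lookup; tabulate)
open import Data.Vec.Properties using (lookup∘tabulate)
open import Data.Vec.Relation.Binary.Pointwise.Extensional using (ext; Pointwise-≡⇒≡)
open import Data.Product using (_×_; _,_; ∃-syntax; proj₁; proj₂)
open import Data.Empty using (⊥-elim)
open import Relation.Nullary using (yes; no)
open import Relation.Binary using (tri<; tri≈; tri>)
open import Relation.Binary.PropositionalEquality
open import Function using (_∘_)
open import Function.Bundles using (_⇔_; mk⇔; Equivalence)
open import Function.Definitions using (Injective)

open Equivalence using (to; from)

[m%o+n]%o≡[m+n]%o : ∀ m n o .{{_ : NonZero o}} → (m % o + n) % o ≡ (m + n) % o
[m%o+n]%o≡[m+n]%o m n o = begin
  (m % o + n) % o          ≡⟨ %-distribˡ-+ (m % o) n o ⟩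
  (m % o % o + n % o) % o  ≡⟨ cong (λ t → (t + n % o) % o) (m%n%n≡m%n m o) ⟩
  (m % o + n % o) % o      ≡⟨ %-distribˡ-+ m n o ⟨
  (m + n) % o              ∎
  where open ≡-Reasoning

[m+n%o]%o≡[m+n]%o : ∀ m n o .{{_ : NonZero o}} → (m + n % o) % o ≡ (m + n) % o
[m+n%o]%o≡[m+n]%o m n o = begin
  (m + n % o) % o  ≡⟨ cong (_% o) (+-comm m (n % o)) ⟩
  (n % o + m) % o  ≡⟨ [m%o+n]%o≡[m+n]%o n m o ⟩
  (n + m) % o      ≡⟨ cong (_% o) (+-comm n m) ⟩
  (m + n) % o      ∎
  where open ≡-Reasoning

[o∸m+[m+n]]%o≡n : ∀ {m n} o .{{_ : NonZero o}} → m ≤ o → n < o → (o ∸ m + (m + n)) % o ≡ n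
[o∸m+[m+n]]%o≡n {m} {n} o m≤o n<o = begin
  (o ∸ m + (m + n)) % o  ≡⟨ cong (_% o) (+-assoc (o ∸ m) m n) ⟨
  (o ∸ m + m + n) % o    ≡⟨ cong (λ t → (t + n) % o) (m∸n+n≡m m≤o) ⟩
  (o + n) % o            ≡⟨ cong (_% o) (+-comm o n) ⟩
  (n + o) % o            ≡⟨ [m+n]%n≡m%n n o ⟩
  n % o                  ≡⟨ m<n⇒m%n≡m n<o ⟩
  n                      ∎
  where open ≡-Reasoning

-- Adding o ∸ m % o is an inverse of adding m modulo o.
+-%-cancelˡ : ∀ m {n p} o .{{_ : NonZero o}} → n < o → p < o → (m + n) % o ≡ (m + p) % o → n ≡ p
+-%-cancelˡ m {n} {p} o n<o p<o eq = begin
  n                          ≡⟨ [o∸m+[m+n]]%o≡n o (m%n≤n m o) n<o ⟨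
  (o ∸ r + (r + n)) % o      ≡⟨ [m+n%o]%o≡[m+n]%o (o ∸ r) (r + n) o ⟨
  (o ∸ r + (r + n) % o) % o  ≡⟨ cong (λ t → (o ∸ r + t) % o) reduced ⟩
  (o ∸ r + (r + p) % o) % o  ≡⟨ [m+n%o]%o≡[m+n]%o (o ∸ r) (r + p) o ⟩
  (o ∸ r + (r + p)) % o      ≡⟨ [o∸m+[m+n]]%o≡n o (m%n≤n m o) p<o ⟩
  p                          ∎
  where
  open ≡-Reasoning
  r : ℕ
  r = m % o
  reduced : (r + n) % o ≡ (r + p) % o
  reduced = trans ([m%o+n]%o≡[m+n]%o m n o) (trans eq (sym ([m%o+n]%o≡[m+n]%o m p o)))

[m+n]%o≡n⇒[m+p]%o≡p : ∀ m {n p} o .{{_ : NonZero o}} → n < o → p < o → (m + n) % o ≡ n → (m + p) % o ≡ p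
[m+n]%o≡n⇒[m+p]%o≡p m {n} {p} o n<o p<o fixes-n = begin
  (m + p) % o      ≡⟨ [m%o+n]%o≡[m+n]%o m p o ⟨
  (m % o + p) % o  ≡⟨ cong (λ t → (t + p) % o) m%o≡0 ⟩
  p % o            ≡⟨ m<n⇒m%n≡m p<o ⟩
  p                ∎
  where
  open ≡-Reasoning
  m%o≡0 : m % o ≡ 0
  m%o≡0 = +-%-cancelˡ n o (m%n<n m o) (≤-<-trans z≤n n<o) (begin
    (n + m % o) % o  ≡⟨ cong (_% o) (+-comm n (m % o)) ⟩
    (m % o + n) % o  ≡⟨ [m%o+n]%o≡[m+n]%o m n o ⟩
    (m + n) % o      ≡⟨ fixes-n ⟩
    n                ≡⟨ m<n⇒m%n≡m n<o ⟨
    n % o            ≡⟨ cong (_% o) (+-identityʳ n) ⟨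
    (n + 0) % o      ∎)

m*u+c<m*v+d : ∀ m {u v c d} → c < m → u < v → m * u + c < m * v + d
m*u+c<m*v+d m {u} {v} {c} {d} c<m u<v = begin-strict
  m * u + c  <⟨ +-monoʳ-< (m * u) c<m ⟩
  m * u + m  ≡⟨ +-comm (m * u) m ⟩
  m + m * u  ≡⟨ *-suc m u ⟨
  m * suc u  ≤⟨ *-monoʳ-≤ m u<v ⟩
  m * v      ≤⟨ m≤m+n (m * v) d ⟩
  m * v + d  ∎
  where open ≤-Reasoning

injective⇒surjective : ∀ {k} (f : Fin k → Fin k) → Injective _≡_ _≡_ f → ∀ v → ∃[ a ] f a ≡ v
injective⇒surjective {suc k} f f-inj v with any? (λ a → f a ≟ᶠ v)
... | yes hit = hit
... | no miss = ⊥-elim (<-irrefl refl (injective⇒≤ squeezed-inj))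
  where
  f≢v : ∀ a → v ≢ f a
  f≢v a v≡fa = miss (a , sym v≡fa)
  squeezed : Fin (suc k) → Fin k
  squeezed a = punchOut (f≢v a)
  squeezed-inj : Injective _≡_ _≡_ squeezed
  squeezed-inj {a} {b} eq = f-inj (punchOut-injective (f≢v a) (f≢v b) eq)

count< : ∀ {k} → (Fin k → ℕ) → ℕ → ℕ
count< {zero} w x = 0
count< {suc k} w x with w fzero <? x
... | yes _ = suc (count< (w ∘ fsuc) x)
... | no _ = count< (w ∘ fsuc) x

count<-≤ : ∀ {k} (w : Fin k → ℕ) x → count< w x ≤ k
count<-≤ {zero} w x = z≤n
count<-≤ {suc k} w x with w fzero <? x
... | yes _ = s≤s (count<-≤ (w ∘ fsuc) x)
... | no _ = m≤n⇒m≤1+n (count<-≤ (w ∘ fsuc) x)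

count<-< : ∀ {k} (w : Fin k → ℕ) {x} a → x ≤ w a → count< w x < k
count<-< {suc k} w {x} a x≤wa with w fzero <? x | a
... | yes w0<x | fzero = ⊥-elim (<-irrefl refl (<-≤-trans w0<x x≤wa))
... | no _ | fzero = s≤s (count<-≤ (w ∘ fsuc) x)
... | yes _ | fsuc a' = s≤s (count<-< (w ∘ fsuc) a' x≤wa)
... | no _ | fsuc a' = m≤n⇒m≤1+n (count<-< (w ∘ fsuc) a' x≤wa)

count<-mono : ∀ {k} (w : Fin k → ℕ) {x y} → x ≤ y → count< w x ≤ count< w y
count<-mono {zero} w x≤y = z≤n
count<-mono {suc k} w {x} {y} x≤y with w fzero <? x | w fzero <? y
... | yes _ | yes _ = s≤s (count<-mono (w ∘ fsuc) x≤y)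
... | yes w0<x | no w0≮y = ⊥-elim (w0≮y (<-≤-trans w0<x x≤y))
... | no _ | yes _ = m≤n⇒m≤1+n (count<-mono (w ∘ fsuc) x≤y)
... | no _ | no _ = count<-mono (w ∘ fsuc) x≤y

count<-strict : ∀ {k} (w : Fin k → ℕ) {x y} a → x ≤ w a → w a < y → count< w x < count< w y
count<-strict {suc k} w {x} {y} a x≤wa wa<y with w fzero <? x | w fzero <? y | a
... | yes w0<x | _ | fzero = ⊥-elim (<-irrefl refl (<-≤-trans w0<x x≤wa))
... | no _ | yes _ | fzero = s≤s (count<-mono (w ∘ fsuc) (<⇒≤ (≤-<-trans x≤wa wa<y)))
... | no _ | no w0≮y | fzero = ⊥-elim (w0≮y wa<y)
... | yes _ | yes _ | fsuc a' = s≤s (count<-strict (w ∘ fsuc) a' x≤wa wa<y)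
... | yes w0<x | no w0≮y | fsuc a' = ⊥-elim (w0≮y (<-trans w0<x (≤-<-trans x≤wa wa<y)))
... | no _ | yes _ | fsuc a' = m≤n⇒m≤1+n (count<-strict (w ∘ fsuc) a' x≤wa wa<y)
... | no _ | no _ | fsuc a' = count<-strict (w ∘ fsuc) a' x≤wa wa<y

count<-none : ∀ {k} (w : Fin k → ℕ) {x} → (∀ b → x ≤ w b) → count< w x ≡ 0
count<-none {zero} w below = refl
count<-none {suc k} w {x} below with w fzero <? x
... | yes w0<x = ⊥-elim (<-irrefl refl (<-≤-trans w0<x (below fzero)))
... | no _ = count<-none (w ∘ fsuc) (below ∘ fsuc)

count<-all : ∀ {k} (w : Fin k → ℕ) {x} → (∀ b → w b < x) → count< w x ≡ k
count<-all {zero} w above = refl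
count<-all {suc k} w {x} above with w fzero <? x
... | yes _ = cong suc (count<-all (w ∘ fsuc) (above ∘ fsuc))
... | no w0≮x = ⊥-elim (w0≮x (above fzero))

count<-allBut : ∀ {k} (w : Fin k → ℕ) {x} a → (∀ b → b ≢ a → w b < x) → x ≤ w a → suc (count< w x) ≡ k
count<-allBut {suc k} w {x} a above x≤wa with w fzero <? x | a
... | yes w0<x | fzero = ⊥-elim (<-irrefl refl (<-≤-trans w0<x x≤wa))
... | no _ | fzero = cong suc (count<-all (w ∘ fsuc) (λ b → above (fsuc b) λ ()))
... | yes _ | fsuc a' =
  cong suc (count<-allBut (w ∘ fsuc) a' (λ b b≢a' → above (fsuc b) (b≢a' ∘ fsuc-injective)) x≤wa)
... | no w0≮x | fsuc a' = ⊥-elim (w0≮x (above fzero λ ()))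

rank : ∀ {k} → (Fin k → ℕ) → Fin k → ℕ
rank w a = count< w (w a)

rank-< : ∀ {k} (w : Fin k → ℕ) a → rank w a < k
rank-< w a = count<-< w a ≤-refl

rank-mono : ∀ {k} (w : Fin k → ℕ) {a b} → w a < w b → rank w a < rank w b
rank-mono w {a} wa<wb = count<-strict w a ≤-refl wa<wb

rank-minimum : ∀ {k} (w : Fin k → ℕ) {a} → (∀ b → w a ≤ w b) → rank w a ≡ 0
rank-minimum w minimum = count<-none w minimum

rank-maximum : ∀ {k} (w : Fin k → ℕ) {a} → Injective _≡_ _≡_ w → (∀ b → w b ≤ w a) → suc (rank w a) ≡ k
rank-maximum w {a} w-inj maximum = count<-allBut w a below ≤-refl
  where
  below : ∀ b → b ≢ a → w b < w a
  below b b≢a = ≤∧≢⇒< (maximum b) (b≢a ∘ w-inj)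

OrderIso : ∀ {k} → (Fin k → ℕ) → (Fin k → ℕ) → Set
OrderIso w v = ∀ a b → (w a < w b) ⇔ (v a < v b)

orderIso-sym : ∀ {k} {w v : Fin k → ℕ} → OrderIso w v → OrderIso v w
orderIso-sym iso a b = mk⇔ (from (iso a b)) (to (iso a b))

orderIso-trans : ∀ {k} {u v w : Fin k → ℕ} → OrderIso u v → OrderIso v w → OrderIso u w
orderIso-trans uv vw a b = mk⇔ (to (vw a b) ∘ to (uv a b)) (from (uv a b) ∘ from (vw a b))

orderIso-respʳ : ∀ {k} {w v v' : Fin k → ℕ} → (∀ a → v a ≡ v' a) → OrderIso w v → OrderIso w v'
orderIso-respʳ v≗v' iso a b = mk⇔
  (subst₂ _<_ (v≗v' a) (v≗v' b) ∘ to (iso a b))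
  (from (iso a b) ∘ subst₂ _<_ (sym (v≗v' a)) (sym (v≗v' b)))

orderIso-injective : ∀ {k} {w v : Fin k → ℕ} → Injective _≡_ _≡_ w → OrderIso w v → Injective _≡_ _≡_ v
orderIso-injective {w = w} w-inj iso {a} {b} va≡vb with <-cmp (w a) (w b)
... | tri< wa<wb _ _ = ⊥-elim (<⇒≢ (to (iso a b) wa<wb) va≡vb)
... | tri≈ _ wa≡wb _ = w-inj wa≡wb
... | tri> _ _ wb<wa = ⊥-elim (<⇒≢ (to (iso b a) wb<wa) (sym va≡vb))

mono⇒orderIso : ∀ {k} {w v : Fin k → ℕ} → Injective _≡_ _≡_ v → (∀ {a b} → v a < v b → w a < w b) → OrderIso w v
mono⇒orderIso {w = w} {v} v-inj mono a b = mk⇔ reflect mono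
  where
  reflect : w a < w b → v a < v b
  reflect wa<wb with <-cmp (v a) (v b)
  ... | tri< va<vb _ _ = va<vb
  ... | tri≈ _ va≡vb _ = ⊥-elim (<-irrefl (cong w (v-inj va≡vb)) wa<wb)
  ... | tri> _ _ vb<va = ⊥-elim (<-asym wa<wb (mono vb<va))

rank-orderIso : ∀ {k} (w : Fin k → ℕ) → Injective _≡_ _≡_ w → OrderIso w (rank w)
rank-orderIso w w-inj = orderIso-sym (mono⇒orderIso w-inj (rank-mono w))

-- By strong induction on the common value v: if ρ a < v it is a value τ d
-- already shared, forcing d = a; if ρ a > v, the preimage of v under ρ
-- would be a smaller τ-value not shared.
orderIso⇒≡ : ∀ {k} (τ ρ : Fin k → Fin k) → Injective _≡_ _≡_ τ →
  OrderIso (toℕ ∘ τ) (toℕ ∘ ρ) → ∀ a → τ a ≡ ρ a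
orderIso⇒≡ {k} τ ρ τ-inj iso a = toℕ-injective (sym (<-rec Agrees agrees (toℕ (τ a)) a refl))
  where
  Agrees : ℕ → Set
  Agrees v = ∀ a → toℕ (τ a) ≡ v → toℕ (ρ a) ≡ v

  ρ-inj : Injective _≡_ _≡_ ρ
  ρ-inj = orderIso-injective (τ-inj ∘ toℕ-injective) iso ∘ cong toℕ

  agrees : ∀ v → (∀ {u} → u < v → Agrees u) → Agrees v
  agrees v ih a τa≡v with <-cmp (toℕ (ρ a)) v
  ... | tri≈ _ ρa≡v _ = ρa≡v
  ... | tri< ρa<v _ _ = ⊥-elim (<-irrefl τa≡v (subst (λ x → toℕ (τ x) < v) d≡a τd<v))
    where
    d : Fin k
    d = proj₁ (injective⇒surjective τ τ-inj (ρ a))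
    τd≡ρa : toℕ (τ d) ≡ toℕ (ρ a)
    τd≡ρa = cong toℕ (proj₂ (injective⇒surjective τ τ-inj (ρ a)))
    τd<v : toℕ (τ d) < v
    τd<v = subst (_< v) (sym τd≡ρa) ρa<v
    d≡a : d ≡ a
    d≡a = ρ-inj (toℕ-injective (trans (ih τd<v d refl) τd≡ρa))
  ... | tri> _ _ v<ρa = ⊥-elim (<-irrefl (trans (sym (ih τc<v c refl)) ρc≡v) τc<v)
    where
    v<k : v < k
    v<k = <-trans v<ρa (toℕ<n (ρ a))
    c : Fin k
    c = proj₁ (injective⇒surjective ρ ρ-inj (fromℕ< v<k))
    ρc≡v : toℕ (ρ c) ≡ v
    ρc≡v = trans (cong toℕ (proj₂ (injective⇒surjective ρ ρ-inj (fromℕ< v<k)))) (toℕ-fromℕ< v<k)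
    τc<v : toℕ (τ c) < v
    τc<v = subst (toℕ (τ c) <_) τa≡v (from (iso c a) (subst (_< toℕ (ρ a)) (sym ρc≡v) v<ρa))

std : ∀ {k} → (Fin k → ℕ) → Word k
std w = tabulate (λ a → fromℕ< (rank-< w a))

toℕ-std : ∀ {k} (w : Fin k → ℕ) a → toℕ (lookup (std w) a) ≡ rank w a
toℕ-std w a = trans (cong toℕ (lookup∘tabulate _ a)) (toℕ-fromℕ< (rank-< w a))

std-orderIso : ∀ {k} {w : Fin k → ℕ} → Injective _≡_ _≡_ w → OrderIso w (toℕ ∘ lookup (std w))
std-orderIso {w = w} w-inj = orderIso-respʳ (sym ∘ toℕ-std w) (rank-orderIso w w-inj)

std-isPerm : ∀ {k} {w : Fin k → ℕ} → Injective _≡_ _≡_ w → IsPerm (std w)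
std-isPerm w-inj a b eq = orderIso-injective w-inj (std-orderIso w-inj) (cong toℕ eq)

window : ∀ {n k} → Vec (Fin n) n → Fin n → Fin k → ℕ
window σ j a = cyc σ (toℕ j + toℕ a)

window-< : ∀ {n k} (σ : Vec (Fin (suc n)) (suc n)) j (a : Fin k) → window σ j a < suc n
window-< σ j a = toℕ<n _

cyc-injective : ∀ {n} (σ : Vec (Fin (suc n)) (suc n)) → IsPerm σ →
  ∀ x y → cyc σ x ≡ cyc σ y → x % suc n ≡ y % suc n
cyc-injective {n} σ σp x y eq = begin
  x % suc n           ≡⟨ toℕ-fromℕ< _ ⟨
  toℕ (x mod suc n)   ≡⟨ cong toℕ (σp _ _ (toℕ-injective eq)) ⟩
  toℕ (y mod suc n)   ≡⟨ toℕ-fromℕ< _ ⟩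
  y % suc n           ∎
  where open ≡-Reasoning

window-injective : ∀ {n k} (σ : Vec (Fin (suc n)) (suc n)) → IsPerm σ → k ≤ suc n →
  ∀ j → Injective _≡_ _≡_ (window {k = k} σ j)
window-injective {n} σ σp k≤n j {a} {b} eq = toℕ-injective
  (+-%-cancelˡ (toℕ j) (suc n) (<-≤-trans (toℕ<n a) k≤n) (<-≤-trans (toℕ<n b) k≤n)
    (cyc-injective σ σp (toℕ j + toℕ a) (toℕ j + toℕ b) eq))

window-through : ∀ {n k} (σ : Vec (Fin (suc n)) (suc n)) → k ≤ suc n →
  ∀ (i : Fin k) p → ∃[ j ] window σ j i ≡ toℕ (lookup σ p)
window-through {n} σ k≤n i p =
  let j , j↦p = injective⇒surjective rotate rotate-injective p in j , cong (toℕ ∘ lookup σ) j↦p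
  where
  rotate : Fin (suc n) → Fin (suc n)
  rotate j = (toℕ j + toℕ i) mod suc n
  rotate-injective : Injective _≡_ _≡_ rotate
  rotate-injective {j} {j'} eq = toℕ-injective (+-%-cancelˡ (toℕ i) (suc n) (toℕ<n j) (toℕ<n j') (begin
    (toℕ i + toℕ j) % suc n    ≡⟨ cong (_% suc n) (+-comm (toℕ i) (toℕ j)) ⟩
    (toℕ j + toℕ i) % suc n    ≡⟨ toℕ-fromℕ< _ ⟨
    toℕ (rotate j)             ≡⟨ cong toℕ eq ⟩
    toℕ (rotate j')            ≡⟨ toℕ-fromℕ< _ ⟩
    (toℕ j' + toℕ i) % suc n   ≡⟨ cong (_% suc n) (+-comm (toℕ j') (toℕ i)) ⟩
    (toℕ i + toℕ j') % suc n   ∎))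
    where open ≡-Reasoning

unavoidable-byWindows : ∀ {k} (Π : PatternSet k) →
  (∀ {n} (σ : Vec (Fin (suc n)) (suc n)) → IsPerm σ → k ≤ suc n → ∃[ j ] Π (std (window σ j))) →
  Unavoidable Π
unavoidable-byWindows {k} Π hasWindow = suc k , λ where
  (suc n) k<n σ σp avoids →
    let k≤n = <⇒≤ k<n
        j , Πτ = hasWindow σ σp k≤n
    in avoids _ Πτ (k≤n , j , std-orderIso (window-injective σ σp k≤n j))

Πlow-unavoidable : ∀ k (i : Fin k) → Unavoidable (Πlow k i)
Πlow-unavoidable k i = unavoidable-byWindows (Πlow k i) minimumAt-i
  where
  minimumAt-i : ∀ {n} (σ : Vec (Fin (suc n)) (suc n)) → IsPerm σ → k ≤ suc n →
    ∃[ j ] Πlow k i (std (window σ j))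
  minimumAt-i {n} σ σp k≤n =
    j , std-isPerm w-inj , trans (toℕ-std w i) (rank-minimum w λ b → subst (_≤ w b) (sym wi≡0) z≤n)
    where
    minimumPosition : ∃[ p ] lookup σ p ≡ fzero
    minimumPosition = injective⇒surjective (lookup σ) (σp _ _) fzero
    p j : Fin (suc n)
    p = proj₁ minimumPosition
    j = proj₁ (window-through σ k≤n i p)
    w : Fin k → ℕ
    w = window σ j
    w-inj : Injective _≡_ _≡_ w
    w-inj = window-injective σ σp k≤n j
    wi≡0 : w i ≡ 0
    wi≡0 = trans (proj₂ (window-through σ k≤n i p)) (cong toℕ (proj₂ minimumPosition))

Πhigh-unavoidable : ∀ k (i : Fin k) → Unavoidable (Πhigh k i)
Πhigh-unavoidable k i = unavoidable-byWindows (Πhigh k i) maximumAt-i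
  where
  maximumAt-i : ∀ {n} (σ : Vec (Fin (suc n)) (suc n)) → IsPerm σ → k ≤ suc n →
    ∃[ j ] Πhigh k i (std (window σ j))
  maximumAt-i {n} σ σp k≤n =
    j , std-isPerm w-inj , trans (cong suc (toℕ-std w i)) (rank-maximum w w-inj maximum)
    where
    maximumPosition : ∃[ p ] lookup σ p ≡ fromℕ n
    maximumPosition = injective⇒surjective (lookup σ) (σp _ _) (fromℕ n)
    p j : Fin (suc n)
    p = proj₁ maximumPosition
    j = proj₁ (window-through σ k≤n i p)
    w : Fin k → ℕ
    w = window σ j
    w-inj : Injective _≡_ _≡_ w
    w-inj = window-injective σ σp k≤n j
    wi≡n : w i ≡ n
    wi≡n = trans (proj₂ (window-through σ k≤n i p)) (trans (cong toℕ (proj₂ maximumPosition)) (toℕ-fromℕ n))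
    maximum : ∀ b → w b ≤ w i
    maximum b = subst (w b ≤_) (sym wi≡n) (s≤s⁻¹ (window-< σ j b))

module BlowUp {k'} (π : Word (suc k')) (πp : IsPerm π) (m' : ℕ) where
  k m n : ℕ
  k = suc k'
  m = suc m'
  n = m * k

  level : ℕ → ℕ
  level t = toℕ (lookup π (t mod k))

  level-cong : ∀ t t' → t % k ≡ t' % k → level t ≡ level t'
  level-cong t t' eq =
    cong (toℕ ∘ lookup π) (toℕ-injective (trans (toℕ-fromℕ< _) (trans eq (sym (toℕ-fromℕ< _)))))

  level-injective : ∀ t t' → level t ≡ level t' → t % k ≡ t' % k
  level-injective t t' eq = begin
    t % k           ≡⟨ toℕ-fromℕ< _ ⟨
    toℕ (t mod k)   ≡⟨ cong toℕ (πp _ _ (toℕ-injective eq)) ⟩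
    toℕ (t' mod k)  ≡⟨ toℕ-fromℕ< _ ⟩
    t' % k          ∎
    where open ≡-Reasoning

  block<m : ∀ {t} → t < n → t / k < m
  block<m t<n = m<n*o⇒m/o<n t<n

  entry : ℕ → ℕ
  entry t = m * level t + t / k

  entry-< : ∀ {t} → t < n → entry t < n
  entry-< {t} t<n = subst (entry t <_) (+-identityʳ n) (m*u+c<m*v+d m (block<m t<n) (toℕ<n (lookup π (t mod k))))

  entry-injective : ∀ {t t'} → t < n → t' < n → entry t ≡ entry t' → t ≡ t'
  entry-injective {t} {t'} t<n t'<n eq with <-cmp (level t) (level t')
  ... | tri< lt _ _ = ⊥-elim (<⇒≢ (m*u+c<m*v+d m (block<m t<n) lt) eq)
  ... | tri> _ _ gt = ⊥-elim (<⇒≢ (m*u+c<m*v+d m (block<m t'<n) gt) (sym eq))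
  ... | tri≈ _ same _ = begin
    t                   ≡⟨ m≡m%n+[m/n]*n t k ⟩
    t % k + t / k * k   ≡⟨ cong₂ (λ r q → r + q * k) (level-injective t t' same) sameBlock ⟩
    t' % k + t' / k * k ≡⟨ m≡m%n+[m/n]*n t' k ⟨
    t'                  ∎
    where
    open ≡-Reasoning
    sameBlock : t / k ≡ t' / k
    sameBlock = +-cancelˡ-≡ (m * level t) _ _ (trans eq (cong (λ l → m * l + t' / k) (sym same)))

  entryFin : Fin n → Fin n
  entryFin t = fromℕ< (entry-< (toℕ<n t))

  blowUp : Vec (Fin n) n
  blowUp = tabulate entryFin

  toℕ-blowUp : ∀ t → toℕ (lookup blowUp t) ≡ entry (toℕ t)
  toℕ-blowUp t = trans (cong toℕ (lookup∘tabulate entryFin t)) (toℕ-fromℕ< _)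

  blowUp-isPerm : IsPerm blowUp
  blowUp-isPerm a b eq = toℕ-injective (entry-injective (toℕ<n a) (toℕ<n b)
    (trans (sym (toℕ-blowUp a)) (trans (cong toℕ eq) (toℕ-blowUp b))))

  -- k divides n, so reducing a position mod n does not change its level.
  cyc-blowUp : ∀ T → cyc blowUp T ≡ m * level T + T % n / k
  cyc-blowUp T = begin
    toℕ (lookup blowUp (T mod n))   ≡⟨ toℕ-blowUp (T mod n) ⟩
    entry (toℕ (T mod n))           ≡⟨ cong entry (toℕ-fromℕ< (m%n<n T n)) ⟩
    entry (T % n)                   ≡⟨ cong (λ l → m * l + T % n / k) (level-cong (T % n) T T%n%k≡T%k) ⟩
    m * level T + T % n / k         ∎
    where
    open ≡-Reasoning
    T%n%k≡T%k : T % n % k ≡ T % k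
    T%n%k≡T%k = m∣n⇒o%n%m≡o%m k n T (n∣m*n m)

  cyc-blowUp-mono : ∀ {T T'} → level T < level T' → cyc blowUp T < cyc blowUp T'
  cyc-blowUp-mono {T} {T'} lt = subst₂ _<_ (sym (cyc-blowUp T)) (sym (cyc-blowUp T'))
    (m*u+c<m*v+d m (block<m (m%n<n T n)) lt)

  occurrence⇒rotation : ∀ (τ : Word k) → IsPerm τ → ∀ j → OccursAt blowUp τ j →
    ∀ a → lookup τ a ≡ lookup π ((toℕ j + toℕ a) mod k)
  occurrence⇒rotation τ τp j occ =
    orderIso⇒≡ (lookup τ) (λ a → lookup π ((toℕ j + toℕ a) mod k)) (τp _ _)
      (orderIso-trans (orderIso-sym occ) (mono⇒orderIso rotatedLevel-injective window-mono))
    where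
    rotatedLevel : Fin k → ℕ
    rotatedLevel a = level (toℕ j + toℕ a)
    rotatedLevel-injective : Injective _≡_ _≡_ rotatedLevel
    rotatedLevel-injective {a} {b} eq = toℕ-injective (+-%-cancelˡ (toℕ j) k (toℕ<n a) (toℕ<n b)
      (level-injective (toℕ j + toℕ a) (toℕ j + toℕ b) eq))
    window-mono : ∀ {a b} → rotatedLevel a < rotatedLevel b → window blowUp j a < window blowUp j b
    window-mono {a} {b} = cyc-blowUp-mono {toℕ j + toℕ a} {toℕ j + toℕ b}

  occurrence-agreeingAt⇒≡ : ∀ (i : Fin k) (τ : Word k) → IsPerm τ → ∀ j → OccursAt blowUp τ j →
    lookup τ i ≡ lookup π i → τ ≡ π
  occurrence-agreeingAt⇒≡ i τ τp j occ τi≡πi = Pointwise-≡⇒≡ (ext λ a →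
    trans (rotation a) (cong (lookup π) (toℕ-injective (trans (toℕ-fromℕ< _) (fixes a)))))
    where
    rotation : ∀ a → lookup τ a ≡ lookup π ((toℕ j + toℕ a) mod k)
    rotation = occurrence⇒rotation τ τp j occ
    fixes-i : (toℕ j + toℕ i) % k ≡ toℕ i
    fixes-i = trans (sym (toℕ-fromℕ< _)) (cong toℕ (πp _ _ (trans (sym (rotation i)) τi≡πi)))
    fixes : ∀ a → (toℕ j + toℕ a) % k ≡ toℕ a
    fixes a = [m+n]%o≡n⇒[m+p]%o≡p (toℕ j) k (toℕ<n i) (toℕ<n a) fixes-i

properSubsets-avoidable : ∀ {k'} (i : Fin (suc k')) (Π : PatternSet (suc k')) →
  (∀ τ → Π τ → IsPerm τ) → (∀ τ τ' → Π τ → Π τ' → lookup τ i ≡ lookup τ' i) →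
  ∀ Π' → Π' ⊂ Π → Avoidable Π'
properSubsets-avoidable i Π perms agreeAt-i Π' (Π'⊆Π , π , Ππ , π∉Π') (N , unavoidable) =
  unavoidable n (≤-trans (n≤1+n N) (m≤m*n m k)) blowUp blowUp-isPerm avoids
  where
  open BlowUp π (perms π Ππ) N
  avoids : AvoidsAll blowUp Π'
  avoids τ Π'τ (_ , j , occ) =
    π∉Π' (subst Π' (occurrence-agreeingAt⇒≡ i τ (perms τ Πτ) j occ (agreeAt-i τ π Πτ Ππ)) Π'τ)
    where
    Πτ : Π τ
    Πτ = Π'⊆Π τ Π'τ

theorem6p1 : (k : ℕ) (i : Fin k) →
    MinimalUnavoidable (Πlow k i) × MinimalUnavoidable (Πhigh k i)
theorem6p1 (suc k') i =
  (Πlow-unavoidable _ i , properSubsets-avoidable i _ (λ _ → proj₁) λ _ _ τi≡0 τ'i≡0 →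
     toℕ-injective (trans (proj₂ τi≡0) (sym (proj₂ τ'i≡0)))) ,
  (Πhigh-unavoidable _ i , properSubsets-avoidable i _ (λ _ → proj₁) λ _ _ τi≡k τ'i≡k →
     toℕ-injective (suc-injective (trans (proj₂ τi≡k) (sym (proj₂ τ'i≡k)))))
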